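{- Let $P$ be a dual-normal program and $M$ an interpretation. For $m\in M$ let $t_m$ be a fresh atom, let $Q=P^M_m[t_m]$ where $P^M_m=P_r^M\cup\{\bot\leftarrow b\mid b\in\mathrm{at}(P)\setminus M\}\cup\{\bot\leftarrow m\}$, and let $E_0=\emptyset$, $E_i=\{b\mid (H\leftarrow b)\in Q,\ H\subseteq E_{i-1}\}$ for $i\ge1$. Then $M$ is an answer set of $P$ if and only if $M$ is a model of $P$ and for every $m\in M$, $t_m\in\bigcup_{i=0}^\infty E_i$ (where the $E_i$ are computed from $P^M_m[t_m]$).
   Context: A rule $r$ is an expression $a_1\vee\cdots\vee a_l\leftarrow a_{l+1},\ldots,a_m,\mathit{not}\ a_{m+1},\ldots,\mathit{not}\ a_n$ with propositional atoms; $H(r)$ is the set of head atoms, $B^+(r)$, $B^-(r)$ the positive and negative body atoms; a constraint is a rule with $H(r)=\emptyset$; $\bot\leftarrow b$ is the constraint with positive body $\{b\}$. A program is a finite set of rules; $\mathrm{at}(P)$ its atoms; $P_r=\{r\in P\mid H(r)\ne\emptyset\}$. A set $I$ of atoms satisfies $r$ if $(H(r)\cup B^-(r))\cap I\neq\emptyset$ or $B^+(r)\setminus I\neq\emptyset$; a model of $P$ satisfies all its rules. Reduct: $P^I=\{H(r)\leftarrow B^+(r)\mid r\in P, I\cap B^-(r)=\emptyset\}$; $P_r^M=(P_r)^M$. $I$ is an answer set of $P$ if it is an inclusion-minimal model of $P^I$. $P$ is dual-normal if each rule is a constraint or has $|B^+(r)|\le1$. For a program $R$ and fresh atom $t$,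 $R[t]=\{H(r)\leftarrow t,\mathit{not}\ B^-(r)\mid r\in R,B^+(r)=\emptyset\}\cup\{r\in R\mid B^+(r)\ne\emptyset\}$. -}

module Defs where

open import Data.Nat using (ℕ; zero; suc)
open import Data.List using (List; []; _∷_; _++_)
open import Data.List.Membership.Propositional using (_∈_; _∉_)
open import Data.List.Relation.Binary.Subset.Propositional using (_⊆_)
open import Data.List.Relation.Unary.Any using (Any)
open import Data.Product using (Σ; ∃; _×_; _,_)
open import Data.Sum using (_⊎_)
open import Data.Empty using (⊥)
open import Relation.Binary.PropositionalEquality using (_≡_)
open import Relation.Nullary using (¬_)

Atom : Set
Atom = ℕ

-- A rule  H ← B⁺, not B⁻ ; the three atom sets are given by finite lists
-- (read as sets).  A constraint is a rule with empty head.
record Rule : Set where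
  constructor _⇐_∣_
  field
    head : List Atom
    pos  : List Atom
    neg  : List Atom
open Rule public

Program : Set
Program = List Rule

-- Derived (possibly auxiliary) programs are described by a membership predicate.
RuleSet : Set₁
RuleSet = Rule → Set

⟦_⟧ : Program → RuleSet
⟦ P ⟧ r = r ∈ P

Interp : Set
Interp = List Atom

InAt : Program → Atom → Set
InAt P a = Σ Rule λ r → r ∈ P × (a ∈ head r ⊎ a ∈ pos r ⊎ a ∈ neg r)

Satisfies : Interp → Rule → Set
Satisfies I r = Any (λ a → a ∈ I) (head r ++ neg r) ⊎ Any (λ a → a ∉ I) (pos r)

Model : Interp → RuleSet → Set
Model I R = ∀ r → R r → Satisfies I r

Reduct : RuleSet → Interp → RuleSet
Reduct R I r' = Σ Rule λ r → R r × (∀ a → a ∈ neg r → a ∉ I) × (r' ≡ (head r ⇐ pos r ∣ []))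

NonConstraints : RuleSet → RuleSet
NonConstraints R r = R r × ¬ (head r ≡ [])

AnswerSet : Program → Interp → Set
AnswerSet P I = Model I (Reduct ⟦ P ⟧ I)
              × (∀ (J : Interp) → J ⊆ I → Model J (Reduct ⟦ P ⟧ I) → I ⊆ J)

DualNormal : Program → Set
DualNormal P = ∀ r → r ∈ P → (head r ≡ []) ⊎ (∀ x y → x ∈ pos r → y ∈ pos r → x ≡ y)

constraint : Atom → Rule
constraint b = [] ⇐ (b ∷ []) ∣ []

PMm : Program → Interp → Atom → RuleSet
PMm P M m r = Reduct (NonConstraints ⟦ P ⟧) M r
            ⊎ (Σ Atom λ b → InAt P b × b ∉ M × r ≡ constraint b)
            ⊎ r ≡ constraint m

WithT : RuleSet → Atom → RuleSet
WithT R t r' = (Σ Rule λ r → R r × pos r ≡ [] × r' ≡ (head r ⇐ (t ∷ []) ∣ neg r))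
             ⊎ (R r' × ¬ (pos r' ≡ []))

-- E_0 = ∅,  E_i = { b | (H ← b) ∈ Q, H ⊆ E_{i-1} }
-- (a rule "H ← b" has positive body exactly {b} and empty negative body)
E : RuleSet → ℕ → Atom → Set
E Q zero b = ⊥
E Q (suc i) b = Σ Rule λ r → Q r
  × b ∈ pos r × (∀ x → x ∈ pos r → x ≡ b) × neg r ≡ []
  × (∀ h → h ∈ head r → E Q i h)

InClosure : RuleSet → Atom → Set
InClosure Q b = ∃ λ i → E Q i b

module Submission where

-- Fix P, M, m ∈ M and an atom t, and let Q = P^M_m[t].  The rules of Q of the
-- form H ← b (one positive body atom, no negation) are exactly: H(p) ← t for a
-- fact p of P_r^M, H(p) ← b for a rule p of P_r^M whose positive body is {b},
-- ⊥ ← b for b ∈ at(P) ∖ M, and ⊥ ← m.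
--
-- (⇐) Soundness: if K is a model of Q, no atom of ⋃ E_i lies in K (induction on
--     i).  For J ⊆ M a model of P^M with m ∉ J, the set {t} ∪ J is a model of Q
--     as long as t is fresh; so t ∈ ⋃ E_i forces m ∈ J, i.e. M is minimal.
-- (⇒) Completeness: membership in E_i is decidable and all E_i lie in the
--     finite set {t, m} ∪ at(P), so the chain stabilises at some E_k, a set S
--     closed under the rules of Q.  If t ∉ S, then J = M ∖ S is a model of P^M
--     (this is where dual-normality is used); minimality gives m ∈ J, but m ∈ S
--     by the rule ⊥ ← m.  Hence t ∈ S.

open import Defs
open import Data.Nat using (ℕ; zero; suc; _≤_; _<_; z≤n; _≟_)
open import Data.Nat.Properties using (m≤n⇒m<n∨m≡n; ≤-<-trans; <-irrefl; <-≤-trans)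
open import Data.List using (List; []; _∷_; _++_; length; filter; concatMap)
open import Data.List.Properties using (length-filter; ++-identityʳ; ≡-dec)
open import Data.List.Membership.Propositional using (_∈_; _∉_; find; lose)
open import Data.List.Membership.Propositional.Properties using (∈-filter⁺; ∈-filter⁻)
open import Data.List.Membership.DecPropositional _≟_ using (_∈?_)
open import Data.List.Relation.Unary.All as All using (All; all?)
open import Data.List.Relation.Unary.Any as Any using (Any; here; there; any?)
open import Data.List.Relation.Unary.Any.Properties using (++⁺ˡ; ++⁺ʳ; ++⁻; ¬Any[]; concatMap⁺)
open import Data.List.Relation.Binary.Subset.Propositional using (_⊆_)
open import Data.List.Relation.Binary.Sublist.Propositional using (⊆-refl) renaming (_⊆_ to _⊑_)
open import Data.List.Relation.Binary.Sublist.Propositional.Properties using (filter⁺; length-mono-≤; to-≋)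
open import Data.List.Relation.Binary.Pointwise using (Pointwise-≡⇒≡)
open import Data.List.Extrema.Nat using (max; xs≤max)
open import Data.Product using (Σ; ∃; _×_; _,_; proj₁; proj₂)
open import Data.Sum using (_⊎_; inj₁; inj₂; [_,_])
open import Data.Empty using (⊥-elim)
open import Function.Bundles using (_⇔_; mk⇔)
open import Relation.Nullary using (¬_; Dec; yes; no)
open import Relation.Nullary.Decidable using (_×-dec_; _⊎-dec_; ¬?; map′)
open import Relation.Binary.PropositionalEquality using (_≡_; refl; sym; subst)

-- Reduct rules have empty negative body, and  H ++ []  is just H.
any-++[] : {X : Atom → Set} (xs : List Atom) → Any X (xs ++ []) → Any X xs
any-++[] {X} xs = subst (Any X) (++-identityʳ xs)

-- An interpretation I is a model of R iff it is a model of the reduct R^I: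
-- the rules deleted by the reduct are satisfied through their negative body.
model⇒reduct-model : (R : RuleSet) (I : Interp) → Model I R → Model I (Reduct R I)
model⇒reduct-model R I mod _ (p , Rp , neg∩I=∅ , refl) with mod p Rp
... | inj₂ a = inj₂ a
... | inj₁ a with ++⁻ (head p) a
...   | inj₁ h = inj₁ (++⁺ˡ h)
...   | inj₂ n = let (x , x∈ , x∈I) = find n in ⊥-elim (neg∩I=∅ x x∈ x∈I)

reduct-model⇒model : (R : RuleSet) (I : Interp) → Model I (Reduct R I) → Model I R
reduct-model⇒model R I mod p Rp with any? (_∈? I) (neg p)
... | yes a = inj₁ (++⁺ʳ (head p) a)
... | no ¬a with mod _ (p , Rp , (λ x x∈ x∈I → ¬a (lose x∈ x∈I)) , refl)
...   | inj₁ a = inj₁ (++⁺ˡ (any-++[] (head p) a))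
...   | inj₂ a = inj₂ a

-- at(P) as an explicit list, used to bound the sets E_i and to pick fresh atoms.
Mentions : Atom → Rule → Set
Mentions b r = b ∈ head r ⊎ b ∈ pos r ⊎ b ∈ neg r

ruleAtoms : Rule → List Atom
ruleAtoms r = head r ++ pos r ++ neg r

atoms : Program → List Atom
atoms = concatMap ruleAtoms

atoms-complete : (P : Program) {b : Atom} → InAt P b → b ∈ atoms P
atoms-complete P (r , r∈P , b∈r) = concatMap⁺ ruleAtoms (lose r∈P (mentioned b∈r))
  where
  mentioned : ∀ {b} → Mentions b r → b ∈ ruleAtoms r
  mentioned = [ ++⁺ˡ , [ (λ b∈ → ++⁺ʳ (head r) (++⁺ˡ b∈)) , (λ b∈ → ++⁺ʳ (head r) (++⁺ʳ (pos r) b∈)) ] ]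

fresh : (xs : List Atom) → ∃ λ t → t ∉ xs
fresh xs = suc (max 0 xs) , λ t∈ → <-irrefl refl (All.lookup (xs≤max 0 xs) t∈)

-- One derivation step along rules H ← b of Q from premises X; by definition
-- E Q (suc i) is exactly  Step Q (E Q i).
Step : RuleSet → (Atom → Set) → Atom → Set
Step Q X b = Σ Rule λ r → Q r
  × b ∈ pos r × (∀ x → x ∈ pos r → x ≡ b) × neg r ≡ []
  × (∀ h → h ∈ head r → X h)

-- S is closed under Q when every step from S stays in S.  In particular
-- Closed Q (E Q k) says precisely that E_{k+1} ⊆ E_k.
Closed : RuleSet → (Atom → Set) → Set
Closed Q S = ∀ b → Step Q S b → S b

E-mono : (Q : RuleSet) → ∀ i b → E Q i b → E Q (suc i) b
E-mono Q (suc i) b (r , Qr , b∈ , only-b , neg≡[] , heads) =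
  r , Qr , b∈ , only-b , neg≡[] , λ h h∈ → E-mono Q i h (heads h h∈)

-- Soundness of derivations: a model K of Q contains no derivable atom, since
-- a rule H ← b with b ∈ K must have a head atom in K, derivable one stage earlier.
closure-avoids-model : (Q : RuleSet) (K : Interp) → Model K Q → ∀ i b → E Q i b → b ∉ K
closure-avoids-model Q K mod (suc i) b (r , Qr , _ , only-b , neg≡[] , heads) b∈K with mod r Qr
... | inj₂ a = let (x , x∈ , x∉K) = find a in x∉K (subst (_∈ K) (sym (only-b x x∈)) b∈K)
... | inj₁ a with ++⁻ (head r) a
...   | inj₁ h = let (x , x∈ , x∈K) = find h in closure-avoids-model Q K mod i x (heads x x∈) x∈K
...   | inj₂ n = ¬Any[] (subst (Any (_∈ K)) neg≡[] n)

withT-model : (R : RuleSet) (J : Interp) (t : Atom) → Model J R →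
              (∀ r → R r → t ∉ pos r) → Model (t ∷ J) (WithT R t)
withT-model R J t mod t∉bodies _ (inj₁ (r , Rr , pos≡[] , refl)) with mod r Rr
... | inj₁ a = inj₁ (Any.map there a)
... | inj₂ a = ⊥-elim (¬Any[] (subst (Any (_∉ J)) pos≡[] a))
withT-model R J t mod t∉bodies r (inj₂ (Rr , _)) with mod r Rr
... | inj₁ a = inj₁ (Any.map there a)
... | inj₂ a = let (x , x∈ , x∉J) = find a in
  inj₂ (lose x∈ λ { (here refl) → t∉bodies r Rr x∈ ; (there x∈J) → x∉J x∈J })

-- An increasing chain of decidable subsets of a finite list C stabilises:
-- as long as it keeps growing, the number of elements of C it contains grows.
module _ {A : Set} (C : List A) (F : ℕ → A → Set) (F? : ∀ k x → Dec (F k x))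
         (F-mono : ∀ k x → F k x → F (suc k) x) (F⊆C : ∀ k x → F k x → x ∈ C) where

  private
    size : ℕ → ℕ
    size k = length (filter (F? k) C)

    StableOnC : ℕ → Set
    StableOnC k = ∀ x → x ∈ C → F (suc k) x → F k x

    grows : ∀ k → filter (F? k) C ⊑ filter (F? (suc k)) C
    grows k = filter⁺ (F? k) (F? (suc k)) (λ { refl → F-mono k _ }) (⊆-refl {x = C})

    -- a sublist of the same length is the whole list
    stable-or-grows : ∀ k → StableOnC k ⊎ size k < size (suc k)
    stable-or-grows k with m≤n⇒m<n∨m≡n (length-mono-≤ (grows k))
    ... | inj₁ lt = inj₂ lt
    ... | inj₂ eq = inj₁ λ x x∈C Fx → proj₂ (∈-filter⁻ (F? k) {xs = C}
           (subst (x ∈_) (sym (Pointwise-≡⇒≡ (to-≋ eq (grows k)))) (∈-filter⁺ (F? (suc k)) x∈C Fx)))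

    stable-or-large : ∀ n → (∃ λ k → StableOnC k) ⊎ n ≤ size n
    stable-or-large zero = inj₂ z≤n
    stable-or-large (suc n) with stable-or-large n
    ... | inj₁ st = inj₁ st
    ... | inj₂ le with stable-or-grows n
    ...   | inj₁ st = inj₁ (n , st)
    ...   | inj₂ lt = inj₂ (≤-<-trans le lt)

  stabilises : ∃ λ k → ∀ x → F (suc k) x → F k x
  stabilises with stable-or-large (suc (length C))
  ... | inj₁ (k , st) = k , λ x Fx → st x (F⊆C (suc k) x Fx) Fx
  ... | inj₂ large = ⊥-elim (<-irrefl refl (<-≤-trans large (length-filter (F? _) C)))

module Reduction (P : Program) (M : Interp) (m t : Atom) where

  Q : RuleSet
  Q = WithT (PMm P M m) t

  -- p belongs to P_r and survives the reduct by M.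
  Applicable : Rule → Set
  Applicable p = (¬ head p ≡ []) × All (_∉ M) (neg p)

  -- p yields the rule H(p) ← t of Q, with head in X.
  FactFrom : (Atom → Set) → Rule → Set
  FactFrom X p = Applicable p × pos p ≡ [] × All X (head p)

  -- p yields the rule H(p) ← b of Q, with head in X.
  UnitFrom : (Atom → Set) → Atom → Rule → Set
  UnitFrom X b p = Applicable p × b ∈ pos p × All (_≡ b) (pos p) × All X (head p)

  -- The one-step derivations of Q described in terms of P; the four cases are
  -- the four kinds of rules H ← b in Q.
  Derivable : (Atom → Set) → Atom → Set
  Derivable X b = (b ≡ t × Any (FactFrom X) P)
                ⊎ Any (UnitFrom X b) P
                ⊎ (Any (Mentions b) P × b ∉ M)
                ⊎ b ≡ m

  derivable? : {X : Atom → Set} → (∀ x → Dec (X x)) → ∀ b → Dec (Derivable X b)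
  derivable? X? b =
        (b ≟ t ×-dec any? (λ p → applicable? p ×-dec ≡-dec _≟_ (pos p) [] ×-dec all? X? (head p)) P)
    ⊎-dec any? (λ p → applicable? p ×-dec b ∈? pos p ×-dec all? (_≟ b) (pos p) ×-dec all? X? (head p)) P
    ⊎-dec (any? (λ p → b ∈? head p ⊎-dec b ∈? pos p ⊎-dec b ∈? neg p) P ×-dec ¬? (b ∈? M))
    ⊎-dec b ≟ m
    where
    applicable? : ∀ p → Dec (Applicable p)
    applicable? p = ¬? (≡-dec _≟_ (head p) []) ×-dec all? (λ x → ¬? (x ∈? M)) (neg p)

  step⇒derivable : ∀ {X} b → Step Q X b → Derivable X b
  step⇒derivable b (_ , inj₁ (_ , inj₁ (p , (p∈P , head≢[]) , neg∩M=∅ , refl) , pos≡[] , refl) , here refl , _ , _ , heads) =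
    inj₁ (refl , lose p∈P ((head≢[] , All.tabulate (neg∩M=∅ _)) , pos≡[] , All.tabulate (heads _)))
  step⇒derivable b (_ , inj₂ (inj₁ (p , (p∈P , head≢[]) , neg∩M=∅ , refl) , _) , b∈ , only-b , _ , heads) =
    inj₂ (inj₁ (lose p∈P ((head≢[] , All.tabulate (neg∩M=∅ _)) , b∈ , All.tabulate (only-b _) , All.tabulate (heads _))))
  step⇒derivable b (_ , inj₂ (inj₂ (inj₁ (_ , (p , p∈P , b∈p) , b∉M , refl)) , _) , here refl , _) =
    inj₂ (inj₂ (inj₁ (lose p∈P b∈p , b∉M)))
  step⇒derivable b (_ , inj₂ (inj₂ (inj₂ refl) , _) , here refl , _) = inj₂ (inj₂ (inj₂ refl))
  step⇒derivable b (_ , inj₁ (_ , inj₁ (_ , _ , _ , refl) , _ , refl) , there () , _)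
  step⇒derivable b (_ , inj₁ (_ , inj₂ (inj₁ (_ , _ , _ , refl)) , () , _) , _)
  step⇒derivable b (_ , inj₁ (_ , inj₂ (inj₂ refl) , () , _) , _)
  step⇒derivable b (_ , inj₂ (inj₂ (inj₁ (_ , _ , _ , refl)) , _) , there () , _)
  step⇒derivable b (_ , inj₂ (inj₂ (inj₂ refl) , _) , there () , _)

  derivable⇒step : ∀ {X} b → Derivable X b → Step Q X b
  derivable⇒step b (inj₁ (refl , fact)) with find fact
  ... | p , p∈P , (head≢[] , neg∩M=∅) , pos≡[] , heads =
    (head p ⇐ t ∷ [] ∣ []) ,
    inj₁ ((head p ⇐ pos p ∣ []) , inj₁ (p , (p∈P , head≢[]) , (λ _ → All.lookup neg∩M=∅) , refl) , pos≡[] , refl) ,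
    here refl , (λ { _ (here refl) → refl }) , refl , (λ _ → All.lookup heads)
  derivable⇒step b (inj₂ (inj₁ unit)) with find unit
  ... | p , p∈P , (head≢[] , neg∩M=∅) , b∈ , only-b , heads =
    (head p ⇐ pos p ∣ []) ,
    inj₂ (inj₁ (p , (p∈P , head≢[]) , (λ _ → All.lookup neg∩M=∅) , refl) , λ pos≡[] → ¬Any[] (subst (b ∈_) pos≡[] b∈)) ,
    b∈ , (λ _ → All.lookup only-b) , refl , (λ _ → All.lookup heads)
  derivable⇒step b (inj₂ (inj₂ (inj₁ (mentioned , b∉M)))) =
    let (p , p∈P , b∈p) = find mentioned in
    constraint b , inj₂ (inj₂ (inj₁ (b , (p , p∈P , b∈p) , b∉M , refl)) , λ ()) ,
    here refl , (λ { _ (here refl) → refl }) , refl , λ _ ()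
  derivable⇒step b (inj₂ (inj₂ (inj₂ refl))) =
    constraint m , inj₂ (inj₂ (inj₂ refl) , λ ()) ,
    here refl , (λ { _ (here refl) → refl }) , refl , λ _ ()

  E? : ∀ i b → Dec (E Q i b)
  E? zero b = no λ ()
  E? (suc i) b = map′ (derivable⇒step b) (step⇒derivable b) (derivable? (E? i) b)

  E⊆candidates : ∀ i b → E Q i b → b ∈ t ∷ m ∷ atoms P
  E⊆candidates (suc i) b e with step⇒derivable b e
  ... | inj₁ (refl , _) = here refl
  ... | inj₂ (inj₁ unit) = let (p , p∈P , (_ , b∈ , _)) = find unit in
    there (there (atoms-complete P (p , p∈P , inj₂ (inj₁ b∈))))
  ... | inj₂ (inj₂ (inj₁ (mentioned , _))) = let (p , p∈P , b∈p) = find mentioned in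
    there (there (atoms-complete P (p , p∈P , b∈p)))
  ... | inj₂ (inj₂ (inj₂ refl)) = there (here refl)

  closed-stage : ∃ λ k → Closed Q (E Q k)
  closed-stage = stabilises (t ∷ m ∷ atoms P) (E Q) E? (E-mono Q) E⊆candidates

  module _ {S : Atom → Set} (S-closed : Closed Q S) where

    m∈S : S m
    m∈S = S-closed m (derivable⇒step m (inj₂ (inj₂ (inj₂ refl))))

    outside-M⇒S : ∀ {b} p → p ∈ P → Mentions b p → b ∉ M → S b
    outside-M⇒S {b} p p∈P b∈p b∉M = S-closed b (derivable⇒step b (inj₂ (inj₂ (inj₁ (lose p∈P b∈p , b∉M)))))

    fact⇒t∈S : ∀ p → p ∈ P → Applicable p → pos p ≡ [] → (∀ h → h ∈ head p → S h) → S t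
    fact⇒t∈S p p∈P app pos≡[] heads =
      S-closed t (derivable⇒step t (inj₁ (refl , lose p∈P (app , pos≡[] , All.tabulate (heads _)))))

    unit⇒b∈S : ∀ p → p ∈ P → Applicable p → ∀ {b} → b ∈ pos p → (∀ x → x ∈ pos p → x ≡ b) →
               (∀ h → h ∈ head p → S h) → S b
    unit⇒b∈S p p∈P app {b} b∈ only-b heads =
      S-closed b (derivable⇒step b (inj₂ (inj₁ (lose p∈P
        (app , b∈ , All.tabulate (only-b _) , All.tabulate (heads _))))))

  module Complement (dn : DualNormal P) (M-model : Model M (Reduct ⟦ P ⟧ M))
           {S : Atom → Set} (S? : ∀ b → Dec (S b)) (S-closed : Closed Q S) (t∉S : ¬ S t) where

    J : Interp
    J = filter (λ b → ¬? (S? b)) M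

    J⊆M : J ⊆ M
    J⊆M b∈J = proj₁ (∈-filter⁻ (λ b → ¬? (S? b)) {xs = M} b∈J)

    J∩S=∅ : ∀ {b} → S b → b ∉ J
    J∩S=∅ Sb b∈J = proj₂ (∈-filter⁻ (λ b → ¬? (S? b)) {xs = M} b∈J) Sb

    -- head atoms outside J lie in S: either in M ∖ J or outside M
    heads-in-S : ∀ p → p ∈ P → ¬ Any (_∈ J) (head p) → ∀ h → h ∈ head p → S h
    heads-in-S p p∈P head∩J=∅ h h∈ with h ∈? M | S? h
    ... | _ | yes Sh = Sh
    ... | yes h∈M | no ¬Sh = ⊥-elim (head∩J=∅ (lose h∈ (∈-filter⁺ (λ b → ¬? (S? b)) h∈M ¬Sh)))
    ... | no h∉M | no _ = outside-M⇒S S-closed p p∈P (inj₁ h∈) h∉M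

    -- an applicable rule with head in S has its (at most one) body atom in S,
    -- hence outside J; an empty body would put t in S
    body-outside-J : ∀ p → p ∈ P → Applicable p → (∀ h → h ∈ head p → S h) → Any (_∉ J) (pos p)
    body-outside-J p@(_ ⇐ [] ∣ _) p∈P app heads = ⊥-elim (t∉S (fact⇒t∈S S-closed p p∈P app refl heads))
    body-outside-J p@(_ ⇐ b ∷ _ ∣ _) p∈P app heads with dn p p∈P
    ... | inj₁ head≡[] = ⊥-elim (proj₁ app head≡[])
    ... | inj₂ single = here (J∩S=∅ (unit⇒b∈S S-closed p p∈P app (here refl)
                                       (λ x x∈ → single x b x∈ (here refl)) heads))

    -- constraints are inherited from M ⊇ J, other rules by body-outside-J
    complement-model : Model J (Reduct ⟦ P ⟧ M)
    complement-model _ (p@([] ⇐ _ ∣ _) , p∈P , neg∩M=∅ , refl) with M-model _ (p , p∈P , neg∩M=∅ , refl)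
    ... | inj₂ a = inj₂ (Any.map (λ x∉M x∈J → x∉M (J⊆M x∈J)) a)
    complement-model _ (p@((h ∷ hs) ⇐ _ ∣ _) , p∈P , neg∩M=∅ , refl) with any? (_∈? J) (h ∷ hs)
    ... | yes a = inj₁ (++⁺ˡ a)
    ... | no head∩J=∅ = inj₂ (body-outside-J p p∈P ((λ ()) , All.tabulate (neg∩M=∅ _))
                                               (heads-in-S p p∈P head∩J=∅))

  PMm-bodies : ∀ r → PMm P M m r → ∀ {x} → x ∈ pos r → x ≡ m ⊎ InAt P x
  PMm-bodies _ (inj₁ (p , (p∈P , _) , _ , refl)) x∈ = inj₂ (p , p∈P , inj₂ (inj₁ x∈))
  PMm-bodies _ (inj₂ (inj₁ (_ , b∈at , _ , refl))) (here refl) = inj₂ b∈at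
  PMm-bodies _ (inj₂ (inj₂ refl)) (here refl) = inj₁ refl

  PMm-model : (J : Interp) → J ⊆ M → Model J (Reduct ⟦ P ⟧ M) → m ∉ J → Model J (PMm P M m)
  PMm-model J J⊆M J-model m∉J _ (inj₁ (p , (p∈P , _) , neg∩M=∅ , refl)) = J-model _ (p , p∈P , neg∩M=∅ , refl)
  PMm-model J J⊆M J-model m∉J _ (inj₂ (inj₁ (b , _ , b∉M , refl))) = inj₂ (here (λ b∈J → b∉M (J⊆M b∈J)))
  PMm-model J J⊆M J-model m∉J _ (inj₂ (inj₂ refl)) = inj₂ (here m∉J)

  -- (⇐) For fresh t, derivability of t forces m into every model J ⊆ M of P^M,
  -- since otherwise t ∷ J is a model of Q containing t.
  t-derivable⇒m∈models : ¬ InAt P t → t ∉ M → m ∈ M → InClosure Q t →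
                          (J : Interp) → J ⊆ M → Model J (Reduct ⟦ P ⟧ M) → m ∈ J
  t-derivable⇒m∈models t∉P t∉M m∈M (i , t∈E) J J⊆M J-model with m ∈? J
  ... | yes m∈J = m∈J
  ... | no m∉J = ⊥-elim (closure-avoids-model Q (t ∷ J) Q-model i t t∈E (here refl))
    where
    t∉bodies : ∀ r → PMm P M m r → t ∉ pos r
    t∉bodies r Rr t∈ with PMm-bodies r Rr t∈
    ... | inj₁ refl = t∉M m∈M
    ... | inj₂ t∈at = t∉P t∈at

    Q-model : Model (t ∷ J) Q
    Q-model = withT-model (PMm P M m) J t (PMm-model J J⊆M J-model m∉J) t∉bodies

  -- (⇒) If M is an answer set, t lies in the closed stage S = E_k: otherwise
  -- M ∖ S would be a smaller model of P^M missing m.  No freshness is needed.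
  answer-set⇒t-derivable : DualNormal P → AnswerSet P M → m ∈ M → InClosure Q t
  answer-set⇒t-derivable dn (M-model , minimal) m∈M = derive (proj₂ closed-stage) (E? k t)
    where
    k : ℕ
    k = proj₁ closed-stage

    derive : Closed Q (E Q k) → Dec (E Q k t) → InClosure Q t
    derive _ (yes t∈E) = k , t∈E
    derive closed (no t∉E) = ⊥-elim (J∩S=∅ (m∈S closed) (minimal J J⊆M complement-model m∈M))
      where open Complement dn M-model (E? k) closed t∉E

derivability⇒minimal : (P : Program) (M : Interp) →
  (∀ m → m ∈ M → ∀ (t : Atom) → ¬ InAt P t → t ∉ M → InClosure (WithT (PMm P M m) t) t) →
  ∀ (J : Interp) → J ⊆ M → Model J (Reduct ⟦ P ⟧ M) → M ⊆ J
derivability⇒minimal P M derives J J⊆M J-model {m} m∈M =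
  Reduction.t-derivable⇒m∈models P M m t t∉P t∉M m∈M (derives m m∈M t t∉P t∉M) J J⊆M J-model
  where
  t : Atom
  t = proj₁ (fresh (atoms P ++ M))

  t∉P : ¬ InAt P t
  t∉P t∈at = proj₂ (fresh (atoms P ++ M)) (++⁺ˡ (atoms-complete P t∈at))

  t∉M : t ∉ M
  t∉M t∈M = proj₂ (fresh (atoms P ++ M)) (++⁺ʳ (atoms P) t∈M)

corollary1 : (P : Program) → DualNormal P → (M : Interp) →
    AnswerSet P M ⇔
      (Model M ⟦ P ⟧ ×
       (∀ m → m ∈ M → ∀ (t : Atom) → ¬ InAt P t → t ∉ M →
          InClosure (WithT (PMm P M m) t) t))
corollary1 P dn M = mk⇔
  (λ answer → reduct-model⇒model ⟦ P ⟧ M (proj₁ answer) ,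
     λ m m∈M t _ _ → Reduction.answer-set⇒t-derivable P M m t dn answer m∈M)
  (λ (M-model , derives) → model⇒reduct-model ⟦ P ⟧ M M-model ,
     derivability⇒minimal P M derives)
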